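{- Let $T$ be a tree with no vertex of degree $2$ and with $h_1(T)\ge 3$ leaves. Take a planar drawing of $T$ and enumerate its leaves $v_1,\dots,v_{h_1}$ in clockwise cyclic order (the order in which they appear around the outer face). For $1\le i\le h_1-1$ let $P_i$ be the unique $v_i$-$v_{i+1}$-path, and let $P_{h_1}$ be the unique $v_{h_1}$-$v_1$-path. Then the family $\mathcal F=\{P_1,\dots,P_{h_1}\}$ has size $h_1(T)$, separates and covers $E(T)$, and separates and covers $V(T)\cup E^*(T)$.
   Context: A path in a tree is a sequence of distinct vertices with consecutive ones adjacent; it contains its vertices and the edges between consecutive vertices. For a family $\mathcal F$ of paths and an element $s$ (vertex or edge), $\mathcal F(s)$ is the set of paths of $\mathcal F$ containing $s$. For a set $S$ of vertices and/or edges, $\mathcal F$ separates $S$ if $\mathcal F(s)\ne\mathcal F(t)$ for all distinct $s,t\in S$, and covers $S$ if $\mathcal F(s)\ne\emptyset$ for all $s\in S$. $E^*(T)$ is the set of interior edges of $T$, i.e. edges $uv$ with neither $u$ nor $v$ a leaf. -}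

module Defs where

open import Data.Nat using (ℕ; zero; suc; _≤_; _<_; _<?_; s≤s; _≡ᵇ_)
open import Data.Fin using (Fin; zero; suc; toℕ; fromℕ<)
open import Data.Bool using (Bool; T)
open import Data.List using (List; []; _∷_; length; filterᵇ; allFin; head; last; zip; drop)
open import Data.List.Membership.Propositional using (_∈_)
open import Data.List.Relation.Unary.Unique.Propositional using (Unique)
open import Data.List.Relation.Unary.Linked using (Linked)
open import Data.Maybe using (just)
open import Data.Product using (Σ; ∃; ∃-syntax; _×_; _,_; proj₂)
open import Data.Sum using (_⊎_)
open import Data.Empty using (⊥)
open import Data.Unit using (⊤)
open import Relation.Nullary using (¬_; yes; no)
open import Relation.Binary.PropositionalEquality using (_≡_; _≢_)

record Graph (n : ℕ) : Set where
  field
    adj   : Fin n → Fin n → Bool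
    sym   : ∀ u v → T (adj u v) → T (adj v u)
    irrefl : ∀ v → ¬ T (adj v v)

module _ {n : ℕ} (G : Graph n) where
  open Graph G

  Adj : Fin n → Fin n → Set
  Adj u v = T (adj u v)

  deg : Fin n → ℕ
  deg v = length (filterᵇ (adj v) (allFin n))

  Leaf : Fin n → Set
  Leaf v = deg v ≡ 1

  h1 : ℕ
  h1 = length (filterᵇ (λ v → deg v ≡ᵇ 1) (allFin n))

  IsPath : List (Fin n) → Set
  IsPath p = Unique p × Linked Adj p

  PathFrom : Fin n → Fin n → List (Fin n) → Set
  PathFrom u w p = IsPath p × head p ≡ just u × last p ≡ just w

  IsCycle : List (Fin n) → Set
  IsCycle c = 3 ≤ length c × IsPath c ×
              Σ (Fin n) λ a → Σ (Fin n) λ b → head c ≡ just a × last c ≡ just b × Adj b a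

  Connected : Set
  Connected = ∀ u w → ∃[ p ] PathFrom u w p

  Acyclic : Set
  Acyclic = ∀ c → ¬ IsCycle c

  IsTree : Set
  IsTree = Connected × Acyclic

data Elem (n : ℕ) : Set where
  vx : Fin n → Elem n
  ed : Fin n → Fin n → Elem n      -- the (unordered) edge {u,v}

SameElem : ∀ {n} → Elem n → Elem n → Set
SameElem (vx a)   (vx b)   = a ≡ b
SameElem (vx _)   (ed _ _) = ⊥
SameElem (ed _ _) (vx _)   = ⊥
SameElem (ed a b) (ed c d) = (a ≡ c × b ≡ d) ⊎ (a ≡ d × b ≡ c)

OnPath : ∀ {n} → Elem n → List (Fin n) → Set
OnPath (vx a)   p = a ∈ p
OnPath (ed a b) p = ((a , b) ∈ zip p (drop 1 p)) ⊎ ((b , a) ∈ zip p (drop 1 p))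

module _ {n : ℕ} (G : Graph n) where

  InE : Elem n → Set
  InE (vx _)   = ⊥
  InE (ed u v) = Adj G u v

  -- s ∈ V(T) ∪ E*(T)   (E* = edges with neither endpoint a leaf)
  InVE* : Elem n → Set
  InVE* (vx _)   = ⊤
  InVE* (ed u v) = Adj G u v × ¬ Leaf G u × ¬ Leaf G v

-- Families of paths indexed by Fin h: F(s) = { i | s ∈ P i }

module _ {n h : ℕ} (P : Fin h → List (Fin n)) where

  Distinguishes : Elem n → Elem n → Set
  Distinguishes s t = ¬ (∀ i → (OnPath s (P i) → OnPath t (P i)) × (OnPath t (P i) → OnPath s (P i)))

  Separates : (Elem n → Set) → Set
  Separates S = ∀ s t → S s → S t → ¬ SameElem s t → Distinguishes s t

  Covers : (Elem n → Set) → Set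
  Covers S = ∀ s → S s → ∃[ i ] OnPath s (P i)

  -- the paths P₁,…,P_h are pairwise distinct (as subgraphs), i.e. |F| = h
  PairwiseDistinct : Set
  PairwiseDistinct = ∀ i j → i ≢ j → ¬ (∀ s → (OnPath s (P i) → OnPath s (P j)) × (OnPath s (P j) → OnPath s (P i)))

cycSuc : ∀ {h} → Fin h → Fin h
cycSuc {suc m} i with toℕ i <? m
... | yes p = fromℕ< (s≤s p)
... | no _  = zero

-- Planar drawings of a graph, combinatorially: rotation systems.
-- σ v is the clockwise successor among the neighbours of v; it maps N(v)
-- into N(v) and acts transitively on N(v) (a single cyclic order).

_^[_] : ∀ {A : Set} → (A → A) → ℕ → A → A
(f ^[ zero ]) x = x
(f ^[ suc k ]) x = f ((f ^[ k ]) x)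

record Rotation {n : ℕ} (G : Graph n) : Set where
  field
    σ      : Fin n → Fin n → Fin n
    closed : ∀ v u → Adj G v u → Adj G v (σ v u)
    cyclic : ∀ v u w → Adj G v u → Adj G v w → ∃[ k ] (σ v ^[ k ]) u ≡ w

module _ {n : ℕ} (G : Graph n) (ρ : Rotation G) where
  open Rotation ρ

  -- one step of the boundary (face) walk on darts: arrive at w from u,
  -- then leave w towards the next neighbour of w after u
  step : Fin n × Fin n → Fin n × Fin n
  step (u , w) = (w , σ w u)

  -- b is the next leaf after the leaf a when walking around the outer face
  NextLeaf : Fin n → Fin n → Set
  NextLeaf a b = Σ (Fin n) λ u → Adj G u a × Σ ℕ λ k → 1 ≤ k ×
                   (proj₂ ((step ^[ k ]) (u , a)) ≡ b) ×
                   (∀ j → 1 ≤ j → j < k → ¬ Leaf G (proj₂ ((step ^[ j ]) (u , a))))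

  LeafCyclicOrder : ∀ {h} → (Fin h → Fin n) → Set
  LeafCyclicOrder {h} ℓ =
    (∀ i j → ℓ i ≡ ℓ j → i ≡ j) ×
    (∀ i → Leaf G (ℓ i)) ×
    (∀ x → Leaf G x → ∃[ i ] ℓ i ≡ x) ×
    (∀ i → NextLeaf (ℓ i) (ℓ (cycSuc i)))

-- For an edge uz, side u z x records whether x lies on z's side of uz. The edge uz lies on P j
-- exactly when ℓ j and ℓ (j+1) lie on different sides of it. As no vertex has degree 2, every side
-- of an edge, and more generally every region of the tree entered through at most two edges,
-- contains a leaf; hence every edge lies on some P j.
-- The boundary walk from ℓ j to ℓ (j+1) traverses uz where the side changes, and from that dart on
-- its next leaf is determined; so for each edge and direction only one P j crosses the edge in that
-- direction. A vertex b that is not a leaf is then separated from any other element by one of the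
-- paths leaving the (at least three) branches at b; two leaves are separated by the path starting
-- at one of them; and two edges e, f are separated because otherwise side_e (ℓ j) xor side_f (ℓ j)
-- would be constant in j, whereas a leaf beyond e and a leaf between e and f give different values.

module Submission where

open import Defs
open import Data.Bool using (Bool; true; false; not; _xor_; T?)
open import Data.Bool.Properties using (not-¬; ¬-not; not-involutive; not-distribˡ-xor) renaming (_≟_ to _≟ᵇ_)
open import Data.Empty using (⊥; ⊥-elim)
open import Data.Fin using (Fin; zero; suc; toℕ; fromℕ; fromℕ<; inject₁; _≟_)
open import Data.Fin.Induction using (<-weakInduction; <-weakInduction-startingFrom)
open import Data.Fin.Properties using (toℕ-injective; toℕ<n; toℕ-fromℕ; toℕ-fromℕ<; toℕ-inject₁; ≤fromℕ; any?)
open import Data.List using (List; []; _∷_; [_]; _++_; _∷ʳ_; length; last; zip; drop; filter; filterᵇ; allFin)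
open import Data.List.Extrema.Nat using (argmax; argmax-all; f[xs]≤f[argmax])
open import Data.List.Properties using (length-++; ++-assoc; ++-identityʳ; ++-identityʳ-unique; ++-conicalˡ; ∷ʳ-injectiveˡ; ∷-injectiveˡ; ∷-injectiveʳ)
open import Data.List.Membership.Propositional.Properties using (∈-++⁺ˡ; ∈-++⁻; ∈-filter⁺; ∈-filter⁻; ∈-allFin)
import Data.List.Relation.Unary.Unique.Propositional.Properties as Unique
open import Data.List.Membership.Propositional using (_∈_; _∉_)
open import Data.List.Relation.Unary.All using (All; lookup; []; _∷_)
open import Data.List.Relation.Unary.All.Properties using (++⁺; ++⁻ˡ; ¬Any⇒All¬; All¬⇒¬Any; all-filter)
open import Data.List.Relation.Unary.Any using (here; there)
open import Data.List.Relation.Unary.Linked using (Linked; [-]; _∷_)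
open import Data.List.Relation.Unary.Unique.Propositional using (Unique)
open import Data.List.Relation.Unary.AllPairs using ([]; _∷_)
open import Data.Maybe using (just)
open import Data.Maybe.Properties using (just-injective)
open import Data.Nat using (ℕ; zero; suc; _+_; _∸_; _≤_; _<_; _<?_; z≤n; s≤s) renaming (_≟_ to _≟ⁿ_)
open import Data.Nat.Properties using (m+1+n≰m; ≤-refl; ≤-trans; <-cmp; m<n⇒m<1+n; m≤n+m; +-monoˡ-<; m∸n+n≡m; ≤-antisym; ≤-pred; ≮⇒≥; suc-injective; <-irrefl; 1+n≢0)
open import Data.Product.Properties using (×-≡,≡→≡)
open import Data.Product as Product using (∃; ∃₂; ∃-syntax; _×_; _,_; proj₁; proj₂)
open import Data.Sum as Sum using (_⊎_; inj₁; inj₂; [_,_]′)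
open import Function using (_∘_; flip)
open import Relation.Nullary using (¬_; Dec; yes; no; ¬?; _×-dec_; does)
open import Relation.Nullary.Decidable using (decidable-stable; toSum; dec-true; dec-false)
open import Relation.Unary using (Decidable)
open import Relation.Binary.Definitions using (tri<; tri≈; tri>)
open import Relation.Binary.PropositionalEquality using (_≡_; _≢_; refl; sym; trans; cong; cong₂; subst)

true≢false : true ≢ false
true≢false ()

AtMostOne : {A : Set} → (A → Set) → Set
AtMostOne P = ∀ {x y} → P x → P y → x ≡ y

module _ {A : Set} where

  consecutive : List A → List (A × A)
  consecutive p = zip p (drop 1 p)

  ∈-consecutive⇒∈ : ∀ {p : List A} {a c} → (a , c) ∈ consecutive p → a ∈ p × c ∈ p
  ∈-consecutive⇒∈ {x ∷ y ∷ r} (here refl) = here refl , there (here refl)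
  ∈-consecutive⇒∈ {x ∷ y ∷ r} (there m)   = Product.map there there (∈-consecutive⇒∈ m)

  Linked⇒consecutive : ∀ {R : A → A → Set} {p a c} → Linked R p → (a , c) ∈ consecutive p → R a c
  Linked⇒consecutive {p = x ∷ y ∷ r} (Rxy ∷ _) (here refl) = Rxy
  Linked⇒consecutive {p = x ∷ y ∷ r} (_ ∷ Rp)  (there m)   = Linked⇒consecutive Rp m

  Unique⇒consecutive-asym : ∀ {p a c} → Unique p → (a , c) ∈ consecutive p → (c , a) ∉ consecutive p
  Unique⇒consecutive-asym {x ∷ y ∷ r} (x∉ ∷ _) (here refl) (here eq) = lookup x∉ (here refl) (sym (cong proj₁ eq))
  Unique⇒consecutive-asym {x ∷ y ∷ r} (x∉ ∷ _) (here refl) (there m) = lookup x∉ (proj₂ (∈-consecutive⇒∈ m)) refl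
  Unique⇒consecutive-asym {x ∷ y ∷ r} (x∉ ∷ _) (there m) (here refl) = lookup x∉ (proj₂ (∈-consecutive⇒∈ m)) refl
  Unique⇒consecutive-asym {x ∷ y ∷ r} (_ ∷ u)  (there m) (there m')  = Unique⇒consecutive-asym u m m'

  last-∈ : ∀ (x : A) r {z} → last (x ∷ r) ≡ just z → z ∈ x ∷ r
  last-∈ x []      refl = here refl
  last-∈ x (y ∷ r) eq   = there (last-∈ y r eq)

  consecutive-leaving : ∀ {Q : A → Set} → Decidable Q → ∀ {x y} r → Q x → y ∈ x ∷ r → ¬ Q y →
                        ∃₂ λ a c → (a , c) ∈ consecutive (x ∷ r) × Q a × ¬ Q c
  consecutive-leaving Q? r qx (here refl) ¬qy = ⊥-elim (¬qy qx)
  consecutive-leaving Q? {x} (z ∷ r) qx (there y∈) ¬qy with Q? z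
  ... | yes qz = Product.map₂ (Product.map₂ (Product.map₁ there)) (consecutive-leaving Q? r qz y∈ ¬qy)
  ... | no ¬qz = x , z , here refl , qx , ¬qz

  consecutive-entering : ∀ {Q : A → Set} → Decidable Q → ∀ {y z} p → y ∈ p → ¬ Q y → last p ≡ just z → Q z →
                         ∃₂ λ a c → (a , c) ∈ consecutive p × ¬ Q a × Q c
  consecutive-entering Q? (x ∷ r) (here refl) ¬qx lz qz
    with a , c , m , ¬qa , ¬¬qc ← consecutive-leaving (λ a → ¬? (Q? a)) r ¬qx (last-∈ x r lz) (λ ¬qz → ¬qz qz)
    = a , c , m , ¬qa , decidable-stable (Q? c) ¬¬qc
  consecutive-entering Q? (x ∷ y ∷ r) (there m) ¬qy lz qz =
    Product.map₂ (Product.map₂ (Product.map₁ there)) (consecutive-entering Q? (y ∷ r) m ¬qy lz qz)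

  three-distinct : ∀ {L : List A} → Unique L → 3 ≤ length L →
                   ∃[ x ] ∃[ y ] ∃[ z ] x ∈ L × y ∈ L × z ∈ L × x ≢ y × x ≢ z × y ≢ z
  three-distinct {x ∷ y ∷ z ∷ _} ((x≢y ∷ x≢z ∷ _) ∷ (y≢z ∷ _) ∷ _) _ =
    x , y , z , here refl , there (here refl) , there (there (here refl)) , x≢y , x≢z , y≢z
  three-distinct {_ ∷ []}     _ (s≤s ())
  three-distinct {_ ∷ _ ∷ []} _ (s≤s (s≤s ()))

  3≤length : ∀ {L : List A} {x} → x ∈ L → length L ≢ 1 → length L ≢ 2 → 3 ≤ length L
  3≤length {_ ∷ []}        _ ≢1 _  = ⊥-elim (≢1 refl)
  3≤length {_ ∷ _ ∷ []}    _ _  ≢2 = ⊥-elim (≢2 refl)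
  3≤length {_ ∷ _ ∷ _ ∷ _} _ _  _  = s≤s (s≤s (s≤s z≤n))

  length≡1⇒AtMostOne : ∀ {L : List A} → length L ≡ 1 → AtMostOne (_∈ L)
  length≡1⇒AtMostOne {_ ∷ []} _ (here refl) (here refl) = refl

  pigeonhole-three-into-two : ∀ {P Q : A → Set} → AtMostOne P → AtMostOne Q →
                              ∀ {x y z} → x ≢ y → x ≢ z → y ≢ z →
                              P x ⊎ Q x → P y ⊎ Q y → P z ⊎ Q z → ⊥
  pigeonhole-three-into-two P! Q! x≢y x≢z y≢z = λ where
    (inj₁ px) (inj₁ py) _         → x≢y (P! px py)
    (inj₂ qx) (inj₂ qy) _         → x≢y (Q! qx qy)
    (inj₁ px) (inj₂ _)  (inj₁ pz) → x≢z (P! px pz)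
    (inj₂ qx) (inj₁ _)  (inj₂ qz) → x≢z (Q! qx qz)
    (inj₁ _)  (inj₂ qy) (inj₂ qz) → y≢z (Q! qy qz)
    (inj₂ _)  (inj₁ py) (inj₁ pz) → y≢z (P! py pz)

ℕ-leaving : ∀ {Q : ℕ → Set} → Decidable Q → Q 0 → ∀ {k} → ¬ Q k → ∃[ t ] t < k × Q t × ¬ Q (suc t)
ℕ-leaving Q? Q0 {zero}  ¬Q0 = ⊥-elim (¬Q0 Q0)
ℕ-leaving Q? Q0 {suc k} ¬Qk+1 with Q? k
... | yes Qk  = k , ≤-refl , Qk , ¬Qk+1
... | no  ¬Qk = Product.map₂ (Product.map₁ m<n⇒m<1+n) (ℕ-leaving Q? Q0 ¬Qk)

cycSuc-view : ∀ {m} (i : Fin (suc m)) →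
              (toℕ i < m × toℕ (cycSuc i) ≡ suc (toℕ i)) ⊎ (toℕ i ≡ m × cycSuc i ≡ zero)
cycSuc-view {m} i with toℕ i <? m
... | yes i<m = inj₁ (i<m , toℕ-fromℕ< (s≤s i<m))
... | no  i≮m = inj₂ (≤-antisym (≤-pred (toℕ<n i)) (≮⇒≥ i≮m) , refl)

cycSuc-inject₁ : ∀ {m} (i : Fin m) → cycSuc (inject₁ i) ≡ suc i
cycSuc-inject₁ i with cycSuc-view (inject₁ i)
... | inj₁ (_ , eq) = toℕ-injective (trans eq (cong suc (toℕ-inject₁ i)))
... | inj₂ (eq , _) = ⊥-elim (<-irrefl (trans (sym (toℕ-inject₁ i)) eq) (toℕ<n i))

cycSuc-fromℕ : ∀ m → cycSuc (fromℕ m) ≡ zero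
cycSuc-fromℕ m with cycSuc-view (fromℕ m)
... | inj₁ (lt , _) = ⊥-elim (<-irrefl (toℕ-fromℕ m) lt)
... | inj₂ (_ , eq) = eq

cycSuc-injective : ∀ {h} {i j : Fin h} → cycSuc i ≡ cycSuc j → i ≡ j
cycSuc-injective {suc m} {i} {j} eq with cycSuc-view i | cycSuc-view j
... | inj₁ (_ , ei) | inj₁ (_ , ej) = toℕ-injective (suc-injective (trans (sym ei) (trans (cong toℕ eq) ej)))
... | inj₂ (ei , _) | inj₂ (ej , _) = toℕ-injective (trans ei (sym ej))
... | inj₁ (_ , ei) | inj₂ (_ , ej) = ⊥-elim (1+n≢0 (trans (sym ei) (cong toℕ (trans eq ej))))
... | inj₂ (_ , ei) | inj₁ (_ , ej) = ⊥-elim (1+n≢0 (trans (sym ej) (cong toℕ (trans (sym eq) ei))))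

cycSuc-induction : ∀ {h} (P : Fin h → Set) {k} → P k → (∀ j → P j → P (cycSuc j)) → ∀ j → P j
cycSuc-induction {suc m} P {k} Pk P-step = <-weakInduction P P-zero step-inject₁
  where
    step-inject₁ : ∀ i → P (inject₁ i) → P (suc i)
    step-inject₁ i = subst P (cycSuc-inject₁ i) ∘ P-step (inject₁ i)
    P-zero : P zero
    P-zero = subst P (cycSuc-fromℕ m) (P-step _ (<-weakInduction-startingFrom P Pk step-inject₁ (≤fromℕ k)))

cycSuc-leaving : ∀ {h} {Q : Fin h → Set} → Decidable Q → ∀ {k k'} → Q k → ¬ Q k' →
                 ∃[ j ] Q j × ¬ Q (cycSuc j)
cycSuc-leaving {Q = Q} Q? {k} {k'} Qk ¬Qk' with any? (λ j → Q? j ×-dec ¬? (Q? (cycSuc j)))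
... | yes found = found
... | no none = ⊥-elim (¬Qk' (cycSuc-induction Q Qk preserved k'))
  where
    preserved : ∀ j → Q j → Q (cycSuc j)
    preserved j Qj = decidable-stable (Q? (cycSuc j)) (λ ¬Q → none (j , Qj , ¬Q))

cycSuc-entering : ∀ {h} {Q : Fin h → Set} → Decidable Q → ∀ {k k'} → ¬ Q k → Q k' →
                  ∃[ j ] ¬ Q j × Q (cycSuc j)
cycSuc-entering Q? ¬Qk Qk' = Product.map₂ (Product.map₂ (decidable-stable (Q? _)))
  (cycSuc-leaving (¬? ∘ Q?) ¬Qk (λ ¬Qk' → ¬Qk' Qk'))

cycSuc²≢id : ∀ {h} → 3 ≤ h → (i : Fin h) → cycSuc (cycSuc i) ≢ i
cycSuc²≢id {suc m} (s≤s (s≤s (s≤s _))) i eq with cycSuc-view i | cycSuc-view (cycSuc i)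
... | inj₁ (_ , e₁) | inj₁ (_ , e₂) = n≢2+n (trans (sym (cong toℕ eq)) (trans e₂ (cong suc e₁)))
  where
    n≢2+n : ∀ {k} → k ≢ suc (suc k)
    n≢2+n {zero}  ()
    n≢2+n {suc k} e = n≢2+n (suc-injective e)
... | inj₁ (_ , e₁) | inj₂ (e₂ , e₃) with trans (sym e₂) (trans e₁ (cong (suc ∘ toℕ) (trans (sym eq) e₃)))
...   | ()
cycSuc²≢id {suc m} (s≤s (s≤s (s≤s _))) i eq | inj₂ (e₁ , e₂) | inj₁ (_ , e₃)
  with trans (sym e₁) (trans (cong toℕ (sym eq)) (trans e₃ (cong (suc ∘ toℕ) e₂)))
...   | ()
cycSuc²≢id {suc m} (s≤s (s≤s (s≤s _))) i eq | inj₂ (_ , e₂) | inj₂ (e₃ , _) with trans (sym e₃) (cong toℕ e₂)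
...   | ()

module Degrees {n : ℕ} (G : Graph n) where
  open Graph G using (adj) renaming (sym to adj-sym)

  neighbours : Fin n → List (Fin n)
  neighbours v = filterᵇ (adj v) (allFin n)

  ∈-neighbours⁺ : ∀ {v w} → Adj G v w → w ∈ neighbours v
  ∈-neighbours⁺ {v} {w} = ∈-filter⁺ (T? ∘ adj v) (∈-allFin w)

  ∈-neighbours⁻ : ∀ {v w} → w ∈ neighbours v → Adj G v w
  ∈-neighbours⁻ {v} = proj₂ ∘ ∈-filter⁻ (T? ∘ adj v) {xs = allFin n}

  neighbours-unique : ∀ v → Unique (neighbours v)
  neighbours-unique v = Unique.filter⁺ (T? ∘ adj v) (Unique.allFin⁺ n)

  Leaf? : ∀ v → Dec (Leaf G v)
  Leaf? v = deg G v ≟ⁿ 1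

  leaf-neighbour-unique : ∀ {v} → Leaf G v → AtMostOne (Adj G v)
  leaf-neighbour-unique leaf v∼x v∼y = length≡1⇒AtMostOne leaf (∈-neighbours⁺ v∼x) (∈-neighbours⁺ v∼y)

  three-neighbours : ∀ {v w} → ¬ Leaf G v → deg G v ≢ 2 → Adj G v w →
                     ∃[ x ] ∃[ y ] ∃[ z ] Adj G v x × Adj G v y × Adj G v z × x ≢ y × x ≢ z × y ≢ z
  three-neighbours {v} ¬leaf deg≢2 v∼w
    with x , y , z , x∈ , y∈ , z∈ , distinct ← three-distinct (neighbours-unique v) (3≤length (∈-neighbours⁺ v∼w) ¬leaf deg≢2)
    = x , y , z , ∈-neighbours⁻ x∈ , ∈-neighbours⁻ y∈ , ∈-neighbours⁻ z∈ , distinct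

  two-other-neighbours : ∀ {v w} → ¬ Leaf G v → deg G v ≢ 2 → Adj G v w →
                         ∃[ p ] ∃[ q ] Adj G v p × Adj G v q × p ≢ q × p ≢ w × q ≢ w
  two-other-neighbours {v} {w} ¬leaf deg≢2 v∼w
    with x , y , z , v∼x , v∼y , v∼z , x≢y , x≢z , y≢z ← three-neighbours ¬leaf deg≢2 v∼w
    with x ≟ w | y ≟ w
  ... | yes refl | _        = y , z , v∼y , v∼z , y≢z , x≢y ∘ sym , x≢z ∘ sym
  ... | no x≢w   | yes refl = x , z , v∼x , v∼z , x≢z , x≢w , y≢z ∘ sym
  ... | no x≢w   | no y≢w   = x , y , v∼x , v∼y , x≢y , x≢w , y≢w

  leaf-if-neighbours-in-two : ∀ {v w} {P Q : Fin n → Set} → Adj G v w → deg G v ≢ 2 →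
                              AtMostOne P → AtMostOne Q → (∀ {m} → Adj G v m → P m ⊎ Q m) → Leaf G v
  leaf-if-neighbours-in-two {v} v∼w deg≢2 P! Q! classify = decidable-stable (Leaf? v) λ ¬leaf →
    let x , y , z , v∼x , v∼y , v∼z , x≢y , x≢z , y≢z = three-neighbours ¬leaf deg≢2 v∼w
    in pigeonhole-three-into-two P! Q! x≢y x≢z y≢z (classify v∼x) (classify v∼y) (classify v∼z)

  leaf-∈-PathFrom⇒endpoint : ∀ {v a c} p → Leaf G v → PathFrom G a c p → v ∈ p → v ≡ a ⊎ v ≡ c
  leaf-∈-PathFrom⇒endpoint (x ∷ r)          _    (_ , refl , _)    (here v≡x)        = inj₁ v≡x
  leaf-∈-PathFrom⇒endpoint (x ∷ y ∷ [])     _    (_ , refl , refl) (there (here v≡y)) = inj₂ v≡y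
  leaf-∈-PathFrom⇒endpoint (x ∷ y ∷ y′ ∷ r) leaf ((x∉ ∷ u , x∼y ∷ l) , refl , lc) (there v∈)
    with leaf-∈-PathFrom⇒endpoint (y ∷ y′ ∷ r) leaf ((u , l) , refl , lc) v∈ | l
  ... | inj₂ v≡c        | _         = inj₂ v≡c
  ... | inj₁ refl       | y∼y′ ∷ _  =
    ⊥-elim (lookup x∉ (there (here refl)) (leaf-neighbour-unique leaf (adj-sym x _ x∼y) y∼y′))

module Tree {n : ℕ} (G : Graph n) (connected : Connected G) (acyclic : Acyclic G) where
  open Degrees G
  open Graph G using (irrefl) renaming (sym to adj-sym)
  open import Data.List.Membership.DecPropositional (_≟_ {n}) using (_∈?_)

  infix 4 _∼_
  _∼_ : Fin n → Fin n → Set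
  _∼_ = Adj G

  ∼-sym : ∀ {x y} → x ∼ y → y ∼ x
  ∼-sym = adj-sym _ _

  ∼-irrefl : ∀ {x y} → x ∼ y → x ≢ y
  ∼-irrefl {x} x∼x refl = irrefl x x∼x

  ∈-PathFrom⇒prefix : ∀ q {y b x} → PathFrom G y b q → x ∈ q →
                      ∃₂ λ q′ r → q ≡ q′ ++ r × PathFrom G y x q′
  ∈-PathFrom⇒prefix (y ∷ r) (_ , refl , _) (here refl) = [ y ] , r , refl , ([] ∷ [] , [-]) , refl , refl
  ∈-PathFrom⇒prefix (y ∷ y′ ∷ r) ((y∉ ∷ u , y∼y′ ∷ l) , refl , lb) (there x∈)
    with ∈-PathFrom⇒prefix (y′ ∷ r) ((u , l) , refl , lb) x∈
  ... | y′ ∷ q′ , r′ , eq , (u′ , l′) , refl , lx =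
    y ∷ y′ ∷ q′ , r′ , cong (y ∷_) eq ,
    (++⁻ˡ (y′ ∷ q′) (subst (All (y ≢_)) eq y∉) ∷ u′ , y∼y′ ∷ l′) , refl , lx

  -- Its prefix up to x, preceded by a, would be a cycle.
  neighbour-∉-PathFrom : ∀ {a x y b q} → a ∼ x → a ∼ y → x ≢ y → a ∉ q → PathFrom G y b q → x ∉ q
  neighbour-∉-PathFrom {a} a∼x a∼y x≢y a∉q pq x∈q with ∈-PathFrom⇒prefix _ pq x∈q
  ... | y ∷ q′ , r , eq , (u′ , l′) , refl , lx =
    acyclic (a ∷ y ∷ q′) (long q′ lx , (a∉ ∷ u′ , a∼y ∷ l′) , a , _ , refl , lx , ∼-sym a∼x)
    where
      a∉ : All (a ≢_) (y ∷ q′)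
      a∉ = ++⁻ˡ (y ∷ q′) (subst (All (a ≢_)) eq (¬Any⇒All¬ _ a∉q))
      long : ∀ q′ → last (y ∷ q′) ≡ just _ → 3 ≤ length (a ∷ y ∷ q′)
      long []      refl = ⊥-elim (x≢y refl)
      long (_ ∷ _) _    = s≤s (s≤s (s≤s z≤n))

  -- If x is not on q, then x takes over the role of a, with neighbours x′ and a and the path a ∷ q.
  -- The case splits use [_,_]′ rather than with, which would hide the structural descent on p.
  no-two-PathFrom : ∀ p {q a x y b} → a ∼ x → a ∼ y → x ≢ y → a ∉ p → a ∉ q →
                    PathFrom G x b p → PathFrom G y b q → ⊥
  no-two-PathFrom p {[]} _ _ _ _ _ _ (_ , () , _)
  no-two-PathFrom (x ∷ []) {w ∷ q} a∼x a∼y x≢y _ a∉q (_ , refl , refl) pq@(_ , _ , lq) =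
    neighbour-∉-PathFrom a∼x a∼y x≢y a∉q pq (last-∈ w q lq)
  no-two-PathFrom (x ∷ x′ ∷ p) {y ∷ q} {a} a∼x a∼y x≢y a∉p a∉q
                  ((x∉ ∷ u , x∼x′ ∷ l) , refl , lb) pq@((uq , lq) , refl , lq′) = [ neighbour-∉-PathFrom a∼x a∼y x≢y a∉q pq
    , (λ x∉q → no-two-PathFrom (x′ ∷ p) {a ∷ y ∷ q} x∼x′ (∼-sym a∼x) (λ x′≡a → a∉p (there (here (sym x′≡a))))
                  (All¬⇒¬Any x∉) (λ { (here x≡a) → ∼-irrefl a∼x (sym x≡a) ; (there x∈) → x∉q x∈ })
                  ((u , l) , refl , lb) ((¬Any⇒All¬ _ a∉q ∷ uq , a∼y ∷ lq) , refl , lq′))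
    ]′ (toSum (x ∈? y ∷ q))

  PathFrom-unique : ∀ p {q a b} → PathFrom G a b p → PathFrom G a b q → p ≡ q
  PathFrom-unique (a ∷ []) {_ ∷ []} (_ , refl , _) (_ , refl , _) = refl
  PathFrom-unique (a ∷ []) {_ ∷ y ∷ q} (_ , refl , refl) ((a∉ ∷ _ , _) , refl , lq) =
    ⊥-elim (All¬⇒¬Any a∉ (last-∈ y q lq))
  PathFrom-unique (a ∷ x ∷ p) {_ ∷ []} ((a∉ ∷ _ , _) , refl , lp) (_ , refl , refl) =
    ⊥-elim (All¬⇒¬Any a∉ (last-∈ x p lp))
  PathFrom-unique (a ∷ x ∷ p) {a′ ∷ y ∷ q} ((a∉p ∷ up , a∼x ∷ lp) , refl , lpb) ((a∉q ∷ uq , a∼y ∷ lq) , refl , lqb) =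
    [ (λ x≡y → cong (a ∷_) (PathFrom-unique (x ∷ p) ((up , lp) , refl , lpb)
                     (subst (λ z → PathFrom G z _ (y ∷ q)) (sym x≡y) ((uq , lq) , refl , lqb))))
    , (λ x≢y → ⊥-elim (no-two-PathFrom (x ∷ p) a∼x a∼y x≢y (All¬⇒¬Any a∉p) (All¬⇒¬Any a∉q)
                         ((up , lp) , refl , lpb) ((uq , lq) , refl , lqb)))
    ]′ (toSum (x ≟ y))

  PathFrom-∷ʳ : ∀ p {u x y} → PathFrom G u x p → y ∉ p → x ∼ y → PathFrom G u y (p ∷ʳ y)
  PathFrom-∷ʳ (x ∷ []) (_ , refl , refl) y∉ x∼y =
    (((λ x≡y → y∉ (here (sym x≡y))) ∷ []) ∷ [] ∷ [] , x∼y ∷ [-]) , refl , refl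
  PathFrom-∷ʳ (x ∷ x′ ∷ p) ((x∉ ∷ u , x∼x′ ∷ l) , refl , lb) y∉ x∼y
    with (u′ , l′) , _ , lb′ ← PathFrom-∷ʳ (x′ ∷ p) ((u , l) , refl , lb) (y∉ ∘ there) x∼y =
    ((++⁺ x∉ ((λ x≡y → y∉ (here (sym x≡y))) ∷ []) ∷ u′) , x∼x′ ∷ l′) , refl , lb′

  path : Fin n → Fin n → List (Fin n)
  path x y = proj₁ (connected x y)

  path-valid : ∀ x y → PathFrom G x y (path x y)
  path-valid x y = proj₂ (connected x y)

  path-unique : ∀ {p x y} → PathFrom G x y p → path x y ≡ p
  path-unique {x = x} {y} = PathFrom-unique (path x y) (path-valid x y)

  path-self : ∀ x → path x x ≡ [ x ]
  path-self x = path-unique (([] ∷ [] , [-]) , refl , refl)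

  path-adjacent : ∀ {x y} → x ∼ y → path x y ≡ x ∷ y ∷ []
  path-adjacent x∼y = path-unique (((∼-irrefl x∼y ∷ []) ∷ [] ∷ [] , x∼y ∷ [-]) , refl , refl)

  path-target-injective : ∀ {u x y} → path u x ≡ path u y → x ≡ y
  path-target-injective {u} {x} {y} eq =
    just-injective (trans (sym (proj₂ (proj₂ (path-valid u x)))) (trans (cong last eq) (proj₂ (proj₂ (path-valid u y)))))

  path-∷ʳ-self : ∀ {x m} → path x x ≢ path x m ∷ʳ x
  path-∷ʳ-self {x} {m} e with path x m | path-valid x m | ∷ʳ-injectiveˡ [] _ (trans (sym (path-self x)) e)
  ... | [] | _ , () , _ | _

  ∈-path⇒prefix : ∀ {u w x} → x ∈ path u w → ∃[ r ] path u w ≡ path u x ++ r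
  ∈-path⇒prefix {u} {w} x∈ with q , r , eq , pq ← ∈-PathFrom⇒prefix (path u w) (path-valid u w) x∈ =
    r , trans eq (cong (_++ r) (sym (path-unique pq)))

  path-adjacent-step : ∀ {u x y} → x ∼ y → path u y ≡ path u x ∷ʳ y ⊎ path u x ≡ path u y ∷ʳ x
  path-adjacent-step {u} {x} {y} x∼y with y ∈? path u x | x ∈? path u y
  ... | no y∉ | _     = inj₁ (path-unique (PathFrom-∷ʳ (path u x) (path-valid u x) y∉ x∼y))
  ... | yes _ | no x∉ = inj₂ (path-unique (PathFrom-∷ʳ (path u y) (path-valid u y) x∉ (∼-sym x∼y)))
  ... | yes y∈ | yes x∈
    with r₁ , e₁ ← ∈-path⇒prefix y∈ | r₂ , e₂ ← ∈-path⇒prefix x∈ =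
    ⊥-elim (∼-irrefl x∼y (path-target-injective (sym same)))
    where
      r₂≡[] : r₂ ≡ []
      r₂≡[] = ++-conicalˡ r₂ r₁ (++-identityʳ-unique (path u x)
                (trans e₁ (trans (cong (_++ r₁) e₂) (++-assoc (path u x) r₂ r₁))))
      same : path u y ≡ path u x
      same = trans e₂ (trans (cong (path u x ++_) r₂≡[]) (++-identityʳ (path u x)))

  side : Fin n → Fin n → Fin n → Bool
  side u z x = does (z ∈? path u x)

  side≟ : ∀ u z b → Decidable (λ w → side u z w ≡ b)
  side≟ u z b w = side u z w ≟ᵇ b

  side-true : ∀ {u z x} → z ∈ path u x → side u z x ≡ true
  side-true = dec-true (_ ∈? _)

  side-false : ∀ {u z x} → z ∉ path u x → side u z x ≡ false
  side-false = dec-false (_ ∈? _)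

  side-true⇒∈ : ∀ {u z x} → side u z x ≡ true → z ∈ path u x
  side-true⇒∈ {u} {z} {x} eq with z ∈? path u x
  ... | yes z∈ = z∈

  side-source : ∀ {u z} → u ∼ z → side u z u ≡ false
  side-source {u} u∼z = side-false λ z∈ → ∼-irrefl u∼z (z∈[u] (subst (_ ∈_) (path-self u) z∈))
    where
      z∈[u] : ∀ {z} → z ∈ [ u ] → u ≡ z
      z∈[u] (here z≡u) = sym z≡u

  side-target : ∀ {u z} → u ∼ z → side u z z ≡ true
  side-target u∼z = side-true (subst (_ ∈_) (sym (path-adjacent u∼z)) (there (here refl)))

  endpoint : Fin n → Fin n → Bool → Fin n
  endpoint u z false = u
  endpoint u z true  = z

  side-endpoint : ∀ {u z} → u ∼ z → ∀ b → side u z (endpoint u z b) ≡ b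
  side-endpoint u∼z false = side-source u∼z
  side-endpoint u∼z true  = side-target u∼z

  private
    side-∷ʳ : ∀ {u z x y} → u ∼ z → path u y ≡ path u x ∷ʳ y → side u z x ≢ side u z y → x ≡ u × y ≡ z
    side-∷ʳ {u} {z} {x} {y} u∼z py≡px∷ʳy sides≢ with z ∈? path u x | z ≟ y
    ... | yes z∈ | _ = ⊥-elim (sides≢ (sym (side-true (subst (z ∈_) (sym py≡px∷ʳy) (∈-++⁺ˡ z∈)))))
    ... | no z∉ | no z≢y = ⊥-elim (sides≢ (sym (side-false (z∉px∷ʳy ∘ subst (z ∈_) py≡px∷ʳy))))
      where
        z∉px∷ʳy : z ∉ path u x ∷ʳ y
        z∉px∷ʳy z∈ with ∈-++⁻ (path u x) z∈
        ... | inj₁ z∈px       = z∉ z∈px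
        ... | inj₂ (here z≡y) = z≢y z≡y
    ... | no _ | yes refl =
      path-target-injective (trans (∷ʳ-injectiveˡ (path u x) [ u ] (trans (sym py≡px∷ʳy) (path-adjacent u∼z))) (sym (path-self u))) ,
      refl

  side-crossing : ∀ {u z x y} → u ∼ z → x ∼ y → side u z x ≢ side u z y → (x ≡ u × y ≡ z) ⊎ (x ≡ z × y ≡ u)
  side-crossing u∼z x∼y sides≢ with path-adjacent-step x∼y
  ... | inj₁ eq = inj₁ (side-∷ʳ u∼z eq sides≢)
  ... | inj₂ eq = inj₂ (Product.swap (side-∷ʳ u∼z eq (sides≢ ∘ sym)))

  side-boundary : ∀ {u z w m b} → u ∼ z → w ∼ m → side u z w ≡ b → side u z m ≢ b →
                  w ≡ endpoint u z b × m ≡ endpoint u z (not b)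
  side-boundary u∼z w∼m sw sm with side-crossing u∼z w∼m (λ eq → sm (trans (sym eq) sw))
  side-boundary {b = false} u∼z w∼m sw sm | inj₁ (refl , refl) = refl , refl
  side-boundary {b = true}  u∼z w∼m sw sm | inj₂ (refl , refl) = refl , refl
  side-boundary {b = true}  u∼z w∼m sw sm | inj₁ (refl , refl) = ⊥-elim (not-¬ refl (trans (sym (side-source u∼z)) sw))
  side-boundary {b = false} u∼z w∼m sw sm | inj₂ (refl , refl) = ⊥-elim (not-¬ refl (trans (sym (side-target u∼z)) sw))

  side-convex : ∀ {u z a c p v} → u ∼ z → PathFrom G a c p → side u z a ≡ side u z c → v ∈ p →
                side u z v ≡ side u z a
  side-convex {u} {z} {a} {p = a ∷ r} {v} u∼z ((uniq , linked) , refl , lc) sa≡sc v∈ with side u z v ≟ᵇ side u z a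
  ... | yes sv≡sa = sv≡sa
  ... | no  sv≢sa
    with a₁ , c₁ , m₁ , s₁ , ¬s₁ ← consecutive-leaving (side≟ u z (side u z a)) r refl v∈ sv≢sa
       | a₂ , c₂ , m₂ , ¬s₂ , s₂ ← consecutive-entering (side≟ u z (side u z a)) (a ∷ r) v∈ sv≢sa lc (sym sa≡sc)
    with refl , refl ← side-boundary u∼z (Linked⇒consecutive linked m₁) s₁ ¬s₁
       | refl , refl ← side-boundary u∼z (∼-sym (Linked⇒consecutive linked m₂)) s₂ ¬s₂
    = ⊥-elim (Unique⇒consecutive-asym uniq m₁ m₂)

  OnPath-edge⇒∈ : ∀ {u z : Fin n} {p} → OnPath (ed u z) p → u ∈ p × z ∈ p
  OnPath-edge⇒∈ (inj₁ m) = ∈-consecutive⇒∈ m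
  OnPath-edge⇒∈ (inj₂ m) = Product.swap (∈-consecutive⇒∈ m)

  OnPath-edge⇒sides-differ : ∀ {u z a c p} → u ∼ z → PathFrom G a c p → OnPath (ed u z) p →
                             side u z a ≢ side u z c
  OnPath-edge⇒sides-differ u∼z pp on sa≡sc with u∈ , z∈ ← OnPath-edge⇒∈ on = true≢false
    (trans (sym (side-target u∼z)) (trans (side-convex u∼z pp sa≡sc z∈)
      (trans (sym (side-convex u∼z pp sa≡sc u∈)) (side-source u∼z))))

  sides-differ⇒OnPath-edge : ∀ {u z a c p} → u ∼ z → PathFrom G a c p → side u z a ≢ side u z c →
                             OnPath (ed u z) p
  sides-differ⇒OnPath-edge {u} {z} {a} {p = a ∷ r} u∼z ((_ , linked) , refl , lc) sa≢sc
    with a₁ , c₁ , m , s₁ , ¬s₁ ← consecutive-leaving (side≟ u z (side u z a)) r refl (last-∈ a r lc) (sa≢sc ∘ sym)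
    with side-crossing u∼z (Linked⇒consecutive linked m) (λ eq → ¬s₁ (trans (sym eq) s₁))
  ... | inj₁ (refl , refl) = inj₁ m
  ... | inj₂ (refl , refl) = inj₂ m

  -- The path from w to w′ stays on the b-side of uz, so it avoids x.
  side-off-edge : ∀ {u z x y w w′ b} → u ∼ z → x ∼ y → side u z w ≡ b → side u z w′ ≡ b → side u z x ≢ b →
                  side x y w ≡ side x y w′
  side-off-edge {u} {z} {x} {y} {w} {w′} u∼z x∼y sw sw′ sx≢b = decidable-stable (side x y w ≟ᵇ side x y w′) λ sides≢ →
    sx≢b (trans (side-convex u∼z (path-valid w w′) (trans sw (sym sw′))
                   (proj₁ (OnPath-edge⇒∈ (sides-differ⇒OnPath-edge x∼y (path-valid w w′) sides≢)))) sw)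

  endpoints-same-side : ∀ {u z x y} → u ∼ z → x ∼ y → ¬ SameElem (ed u z) (ed x y) → side x y u ≡ side x y z
  endpoints-same-side u∼z x∼y e≢f = decidable-stable (_ ≟ᵇ _) (e≢f ∘ side-crossing x∼y u∼z)

  side-of-endpoint : ∀ {u z x y} → side x y u ≡ side x y z → ∀ b → side x y (endpoint u z b) ≡ side x y u
  side-of-endpoint _  false = refl
  side-of-endpoint eq true  = sym eq

  branch-unique : ∀ {b p q w} → b ∼ p → b ∼ q → side b p w ≡ true → side b q w ≡ true → p ≡ q
  branch-unique b∼p b∼q sp sq
    with r₁ , e₁ ← ∈-path⇒prefix (side-true⇒∈ sp) | r₂ , e₂ ← ∈-path⇒prefix (side-true⇒∈ sq) =
    ∷-injectiveˡ (∷-injectiveʳ (trans (sym (trans e₁ (cong (_++ r₁) (path-adjacent b∼p))))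
                                      (trans e₂ (cong (_++ r₂) (path-adjacent b∼q)))))

  toward : ∀ {b a} → b ≢ a → ∃[ m ] b ∼ m × side b m a ≡ true
  toward {b} {a} b≢a with path b a | path-valid b a
  ... | _ ∷ []    | _ , refl , refl         = ⊥-elim (b≢a refl)
  ... | x ∷ m ∷ r | (_ , b∼m ∷ _) , refl , _ = m , b∼m , dec-true (m ∈? x ∷ m ∷ r) (there (here refl))

  no-isolated-vertex : ∀ {x y} → x ≢ y → ∀ v → ∃ (v ∼_)
  no-isolated-vertex {x} x≢y v with v ≟ x
  ... | no  v≢x  = Product.map₂ proj₁ (toward v≢x)
  ... | yes refl = Product.map₂ proj₁ (toward x≢y)

  -- The vertex of R farthest from r is a leaf: its neighbours in R are closer to r, so at most its
  -- predecessor, and its neighbours outside R are a₁ and, when it is r itself, a₂.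
  leaf-in-region : (∀ v → deg G v ≢ 2) → (∀ v → ∃ (v ∼_)) →
                   ∀ {R : Fin n → Set} → Decidable R → ∀ {r a₁ a₂} → R r →
                   (∀ {w m} → R w → w ∼ m → ¬ R m → m ≡ a₁ ⊎ (w ≡ r × m ≡ a₂)) →
                   ∃[ w ] R w × Leaf G w
  leaf-in-region no-deg-2 has-neighbour {R} R? {r} {a₁} {a₂} Rr boundary =
    w , Rw , leaf-if-neighbours-in-two {P = _≡ a₁} (proj₂ (has-neighbour w)) (no-deg-2 w) (λ e₁ e₂ → trans e₁ (sym e₂)) Q! classify
    where
      distance : Fin n → ℕ
      distance x = length (path r x)

      w : Fin n
      w = argmax distance r (filter R? (allFin n))

      Rw : R w
      Rw = argmax-all distance Rr (all-filter R? (allFin n))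

      farthest : ∀ {x} → R x → distance x ≤ distance w
      farthest {x} Rx = lookup (f[xs]≤f[argmax] r (filter R? (allFin n))) (∈-filter⁺ R? (∈-allFin x) Rx)

      Q : Fin n → Set
      Q m = (w ≡ r × m ≡ a₂) ⊎ path r w ≡ path r m ∷ʳ w

      root-has-no-predecessor : ∀ {m} → w ≡ r → path r w ≢ path r m ∷ʳ w
      root-has-no-predecessor {m} w≡r = path-∷ʳ-self ∘ subst (λ x → path r x ≡ path r m ∷ʳ x) w≡r

      Q! : AtMostOne Q
      Q! (inj₁ (_ , refl)) (inj₁ (_ , refl)) = refl
      Q! (inj₁ (w≡r , _)) (inj₂ e)          = ⊥-elim (root-has-no-predecessor w≡r e)
      Q! (inj₂ e)          (inj₁ (w≡r , _)) = ⊥-elim (root-has-no-predecessor w≡r e)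
      Q! (inj₂ e₁)         (inj₂ e₂)         = path-target-injective (∷ʳ-injectiveˡ _ _ (trans (sym e₁) e₂))

      classify : ∀ {m} → w ∼ m → m ≡ a₁ ⊎ Q m
      classify {m} w∼m with R? m | path-adjacent-step {r} w∼m
      ... | no ¬Rm | _      = Sum.map₂ inj₁ (boundary Rw w∼m ¬Rm)
      ... | yes _  | inj₂ e = inj₂ (inj₂ e)
      ... | yes Rm | inj₁ e = ⊥-elim (m+1+n≰m (distance w)
            (subst (_≤ distance w) (trans (cong length e) (length-++ (path r w))) (farthest Rm)))

module BoundaryWalk {n : ℕ} (G : Graph n) (connected : Connected G) (acyclic : Acyclic G) (ρ : Rotation G)
                    {h : ℕ} (ℓ : Fin h → Fin n) (ℓ-injective : ∀ i j → ℓ i ≡ ℓ j → i ≡ j)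
                    (ℓ-leaf : ∀ i → Leaf G (ℓ i)) (ℓ-next : ∀ i → NextLeaf G ρ (ℓ i) (ℓ (cycSuc i))) where
  open Tree G connected acyclic
  open Rotation ρ using (closed)

  walk : Fin n × Fin n → ℕ → Fin n × Fin n
  walk d k = (step G ρ ^[ k ]) d

  walk-+ : ∀ d j k → walk (walk d k) j ≡ walk d (j + k)
  walk-+ d zero    k = refl
  walk-+ d (suc j) k = cong (step G ρ) (walk-+ d j k)

  walk-adjacent : ∀ {u w} → u ∼ w → ∀ k → proj₁ (walk (u , w) k) ∼ proj₂ (walk (u , w) k)
  walk-adjacent u∼w zero    = u∼w
  walk-adjacent u∼w (suc k) = closed _ _ (∼-sym (walk-adjacent u∼w k))

  FirstLeaf : Fin n × Fin n → Fin n → Set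
  FirstLeaf d x = ∃[ k ] proj₂ (walk d k) ≡ x × Leaf G x × (∀ j → j < k → ¬ Leaf G (proj₂ (walk d j)))

  FirstLeaf-functional : ∀ {d} → AtMostOne (FirstLeaf d)
  FirstLeaf-functional (k₁ , refl , leaf₁ , before₁) (k₂ , refl , leaf₂ , before₂) with <-cmp k₁ k₂
  ... | tri< k₁<k₂ _ _ = ⊥-elim (before₂ k₁ k₁<k₂ leaf₁)
  ... | tri≈ _ refl _  = refl
  ... | tri> _ _ k₂<k₁ = ⊥-elim (before₁ k₂ k₂<k₁ leaf₂)

  segment-crossing : ∀ i {u z b} → u ∼ z → side u z (ℓ i) ≡ b → side u z (ℓ (cycSuc i)) ≢ b →
                     FirstLeaf (endpoint u z b , endpoint u z (not b)) (ℓ (cycSuc i))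
  segment-crossing i {u} {z} {b} u∼z s≡b s′≢b with ℓ-next i
  ... | v , v∼ℓi , k , 1≤k , end , no-leaf-inside
    with t , t<k , st , ¬st′ ← ℕ-leaving (λ t → side≟ u z b (proj₂ (walk (v , ℓ i) t))) s≡b (s′≢b ∘ subst (λ x → side u z x ≡ b) end)
    = subst (λ d → FirstLeaf d (ℓ (cycSuc i)))
        (×-≡,≡→≡ (side-boundary u∼z (walk-adjacent v∼ℓi (suc t)) st ¬st′))
        (k ∸ suc t , reaches , ℓ-leaf (cycSuc i) , before)
    where
      reaches : proj₂ (walk (walk (v , ℓ i) (suc t)) (k ∸ suc t)) ≡ ℓ (cycSuc i)
      reaches = trans (cong proj₂ (trans (walk-+ _ (k ∸ suc t) (suc t)) (cong (walk (v , ℓ i)) (m∸n+n≡m t<k)))) end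
      before : ∀ j → j < k ∸ suc t → ¬ Leaf G (proj₂ (walk (walk (v , ℓ i) (suc t)) j))
      before j j<k∸s = subst (¬_ ∘ Leaf G ∘ proj₂) (sym (walk-+ _ j (suc t)))
        (no-leaf-inside (j + suc t) (≤-trans (s≤s z≤n) (m≤n+m (suc t) j))
          (subst (j + suc t <_) (m∸n+n≡m t<k) (+-monoˡ-< (suc t) j<k∸s)))

  Exits : Fin n → Fin n → Bool → Fin h → Set
  Exits u z b i = side u z (ℓ i) ≡ b × side u z (ℓ (cycSuc i)) ≢ b

  exit-unique : ∀ {u z} → u ∼ z → ∀ b → AtMostOne (Exits u z b)
  exit-unique u∼z b (s₁ , s₁′) (s₂ , s₂′) =
    cycSuc-injective (ℓ-injective _ _ (FirstLeaf-functional (segment-crossing _ u∼z s₁ s₁′) (segment-crossing _ u∼z s₂ s₂′)))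

SameElem-sym : ∀ {n} {s t : Elem n} → SameElem s t → SameElem t s
SameElem-sym {s = vx _}   {vx _}   eq = sym eq
SameElem-sym {s = ed _ _} {ed _ _} eq = Sum.map (Product.map sym sym) (Product.map sym sym ∘ Product.swap) eq

not-xor-not : ∀ a c → not a xor not c ≡ a xor c
not-xor-not false c = not-involutive c
not-xor-not true  c = refl

xor-preserved : ∀ {a a′ c c′} → (a ≢ a′ → c ≢ c′) → (c ≢ c′ → a ≢ a′) → a xor c ≡ a′ xor c′
xor-preserved {a} {a′} {c} {c′} a-changes c-changes with a ≟ᵇ a′ | c ≟ᵇ c′
... | yes refl | yes refl = refl
... | yes refl | no c≢c′  = ⊥-elim (c-changes c≢c′ refl)
... | no a≢a′  | yes refl = ⊥-elim (a-changes a≢a′ refl)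
... | no a≢a′  | no c≢c′  = trans (cong₂ _xor_ (¬-not a≢a′) (¬-not c≢c′)) (not-xor-not a′ c′)

module Separation {n : ℕ} (G : Graph n) (connected : Connected G) (acyclic : Acyclic G)
                  (no-deg-2 : ∀ v → deg G v ≢ 2) (ρ : Rotation G) {h : ℕ} (3≤h : 3 ≤ h)
                  (ℓ : Fin h → Fin n) (ℓ-injective : ∀ i j → ℓ i ≡ ℓ j → i ≡ j) (ℓ-leaf : ∀ i → Leaf G (ℓ i))
                  (ℓ-surjective : ∀ x → Leaf G x → ∃[ i ] ℓ i ≡ x) (ℓ-next : ∀ i → NextLeaf G ρ (ℓ i) (ℓ (cycSuc i)))
                  (P : Fin h → List (Fin n)) (P-path : ∀ i → PathFrom G (ℓ i) (ℓ (cycSuc i)) (P i)) where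
  open Degrees G
  open Tree G connected acyclic
  open BoundaryWalk G connected acyclic ρ ℓ ℓ-injective ℓ-leaf ℓ-next
  open import Data.List.Membership.DecPropositional (_≟_ {n}) using (_∈?_)

  ℓ≢ℓ-next : ∀ i → ℓ i ≢ ℓ (cycSuc i)
  ℓ≢ℓ-next i eq = cycSuc²≢id 3≤h i (trans (cong cycSuc (sym i≡i′)) (sym i≡i′))
    where
      i≡i′ : i ≡ cycSuc i
      i≡i′ = ℓ-injective _ _ eq

  has-neighbour : ∀ v → ∃ (v ∼_)
  has-neighbour = no-isolated-vertex (ℓ≢ℓ-next (fromℕ< (≤-trans (s≤s z≤n) 3≤h)))

  leaf-index-in-region : ∀ {R : Fin n → Set} → Decidable R → ∀ {r a₁ a₂} → R r →
                         (∀ {w m} → R w → w ∼ m → ¬ R m → m ≡ a₁ ⊎ (w ≡ r × m ≡ a₂)) → ∃[ i ] R (ℓ i)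
  leaf-index-in-region R? Rr boundary with w , Rw , leaf ← leaf-in-region no-deg-2 has-neighbour R? Rr boundary
    with i , refl ← ℓ-surjective w leaf = i , Rw

  leaf-index-on-side : ∀ {u z} → u ∼ z → ∀ b → ∃[ i ] side u z (ℓ i) ≡ b
  leaf-index-on-side {u} {z} u∼z b = leaf-index-in-region (side≟ u z b) {a₂ = endpoint u z (not b)} (side-endpoint u∼z b)
    (λ sw w∼m sm≢b → inj₁ (proj₂ (side-boundary u∼z w∼m sw sm≢b)))

  exit-index : ∀ {u z} → u ∼ z → ∃ (Exits u z true)
  exit-index {u} {z} u∼z = cycSuc-leaving (side≟ u z true ∘ ℓ)
    (proj₂ (leaf-index-on-side u∼z true)) (not-¬ (proj₂ (leaf-index-on-side u∼z false)))

  Exits⇒OnPath : ∀ {u z b j} → u ∼ z → Exits u z b j → OnPath (ed u z) (P j)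
  Exits⇒OnPath u∼z (s , s′) = sides-differ⇒OnPath-edge u∼z (P-path _) (λ eq → s′ (trans (sym eq) s))

  change⇒Exits : ∀ {u z j} → side u z (ℓ j) ≢ side u z (ℓ (cycSuc j)) → Exits u z true j ⊎ Exits u z false j
  change⇒Exits {u} {z} {j} sides≢ with side u z (ℓ j)
  ... | true  = inj₁ (refl , sides≢ ∘ sym)
  ... | false = inj₂ (refl , sides≢ ∘ sym)

  off-or-Exits : ∀ {x y} → x ∼ y → ∀ j → ¬ OnPath (ed x y) (P j) ⊎ (Exits x y true j ⊎ Exits x y false j)
  off-or-Exits {x} {y} x∼y j with side x y (ℓ j) ≟ᵇ side x y (ℓ (cycSuc j))
  ... | yes same   = inj₁ (λ on → OnPath-edge⇒sides-differ x∼y (P-path j) on same)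
  ... | no sides≢ = inj₂ (change⇒Exits sides≢)

  ℓ∈P : ∀ i → ℓ i ∈ P i
  ℓ∈P i with P i | P-path i
  ... | _ ∷ _ | _ , refl , _ = here refl

  ℓ∈P⇒endpoint : ∀ {i j} → ℓ i ∈ P j → i ≡ j ⊎ i ≡ cycSuc j
  ℓ∈P⇒endpoint {i} {j} ℓi∈ = Sum.map (ℓ-injective _ _) (ℓ-injective _ _)
    (leaf-∈-PathFrom⇒endpoint (P j) (ℓ-leaf i) (P-path j) ℓi∈)

  separated-by : ∀ j {s t} → OnPath s (P j) → ¬ OnPath t (P j) → Distinguishes P s t
  separated-by j s∈ t∉ same = t∉ (proj₁ (same j) s∈)

  Distinguishes-sym : ∀ {s t} → Distinguishes P s t → Distinguishes P t s
  Distinguishes-sym dist same = dist (Product.swap ∘ same)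

  Exits⇒source∈P : ∀ {u z b j} → u ∼ z → Exits u z b j → u ∈ P j
  Exits⇒source∈P u∼z = proj₁ ∘ OnPath-edge⇒∈ ∘ Exits⇒OnPath u∼z

  edge-covered : ∀ {u z} → u ∼ z → ∃[ i ] OnPath (ed u z) (P i)
  edge-covered u∼z = Product.map₂ (Exits⇒OnPath u∼z) (exit-index u∼z)

  vertex-covered : ∀ v → ∃[ i ] v ∈ P i
  vertex-covered v = Product.map₂ (proj₁ ∘ OnPath-edge⇒∈) (edge-covered (proj₂ (has-neighbour v)))

  edges-distinguished : ∀ {u z x y} → u ∼ z → x ∼ y → ¬ SameElem (ed u z) (ed x y) →
                        Distinguishes P (ed u z) (ed x y)
  edges-distinguished {u} {z} {x} {y} u∼z x∼y e≢f same =
    let i , outer-e = leaf-index-on-side u∼z (not α)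
        k , middle = leaf-index-in-region R? {a₁ = endpoint u z (not α)} R-root boundary
        j , dj , dj′ = cycSuc-leaving (λ j → d j ≟ᵇ d i) {i} {k} refl
                         (λ dk≡di → not-¬ (cong₂ _xor_ (proj₁ middle) (proj₂ middle))
                           (trans dk≡di (trans (cong₂ _xor_ outer-e (beyond-e outer-e)) (sym (not-distribˡ-xor α β)))))
    in dj′ (trans (sym (d-constant j)) dj)
    where
      α = side u z x
      β = side x y u
      u-z-same-side : side x y u ≡ side x y z
      u-z-same-side = endpoints-same-side u∼z x∼y e≢f
      x-y-same-side : side u z x ≡ side u z y
      x-y-same-side = endpoints-same-side x∼y u∼z (e≢f ∘ SameElem-sym)

      d : Fin h → Bool
      d j = side u z (ℓ j) xor side x y (ℓ j)
      d-constant : ∀ j → d j ≡ d (cycSuc j)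
      d-constant j = xor-preserved
        (OnPath-edge⇒sides-differ x∼y (P-path j) ∘ proj₁ (same j) ∘ sides-differ⇒OnPath-edge u∼z (P-path j))
        (OnPath-edge⇒sides-differ u∼z (P-path j) ∘ proj₂ (same j) ∘ sides-differ⇒OnPath-edge x∼y (P-path j))

      beyond-e : ∀ {w} → side u z w ≡ not α → side x y w ≡ β
      beyond-e sw = trans (side-off-edge u∼z x∼y sw (side-endpoint u∼z (not α)) (not-¬ refl))
                      (side-of-endpoint u-z-same-side (not α))

      R : Fin n → Set
      R w = side u z w ≡ α × side x y w ≡ β
      R? : Decidable R
      R? w = side≟ u z α w ×-dec side≟ x y β w
      R-root : R (endpoint x y β)
      R-root = side-of-endpoint x-y-same-side β , side-endpoint x∼y β
      boundary : ∀ {w m} → R w → w ∼ m → ¬ R m →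
                 m ≡ endpoint u z (not α) ⊎ (w ≡ endpoint x y β × m ≡ endpoint x y (not β))
      boundary {w} {m} (swe , swf) w∼m ¬Rm with side u z m ≟ᵇ α
      ... | no  sme≢α = inj₁ (proj₂ (side-boundary u∼z w∼m swe sme≢α))
      ... | yes sme≡α = inj₂ (side-boundary x∼y w∼m swf (λ smf → ¬Rm (sme≡α , smf)))

  Exits⇒off-branch : ∀ {b p q j} → b ∼ p → b ∼ q → p ≢ q → Exits b p true j → side b q (ℓ j) ≡ false
  Exits⇒off-branch b∼p b∼q p≢q (sp , _) = ¬-not (p≢q ∘ branch-unique b∼p b∼q sp)

  exit-indices-distinct : ∀ {a p q j j′} → a ∼ p → a ∼ q → p ≢ q → Exits a p true j → Exits a q true j′ → j ≢ j′
  exit-indices-distinct a∼p a∼q p≢q (sp , _) (sq , _) refl = p≢q (branch-unique a∼p a∼q sp sq)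

  avoids-branch : ∀ {b p za a j} → b ∼ p → b ∼ za → p ≢ za → side b za a ≡ true →
                  Exits b p true j → side b za (ℓ (cycSuc j)) ≡ false → b ∈ P j × a ∉ P j
  avoids-branch {b} {za = za} {j = j} b∼p b∼za p≢za sa e s′ =
    Exits⇒source∈P b∼p e ,
    λ a∈ → true≢false (trans (sym sa) (trans (side-convex b∼za (P-path j) (trans s (sym s′)) a∈) s))
    where
      s : side b za (ℓ j) ≡ false
      s = Exits⇒off-branch b∼p b∼za p≢za e

  -- Of the paths leaving the branches p and q at b, at most one enters the branch za containing a,
  -- since only one P j crosses bza in that direction; the other one avoids a.
  separated-by-exits : ∀ {b a za p q jp jq} → b ∼ za → side b za a ≡ true → b ∼ p → b ∼ q → p ≢ q → p ≢ za → q ≢ za →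
                       Exits b p true jp → Exits b q true jq → ∃[ j ] b ∈ P j × a ∉ P j
  separated-by-exits {b} {za = za} {jp = jp} {jq} b∼za sa b∼p b∼q p≢q p≢za q≢za ep eq
    with side b za (ℓ (cycSuc jp)) ≟ᵇ false | side b za (ℓ (cycSuc jq)) ≟ᵇ false
  ... | yes s′ | _      = jp , avoids-branch b∼p b∼za p≢za sa ep s′
  ... | no _   | yes s′ = jq , avoids-branch b∼q b∼za q≢za sa eq s′
  ... | no s′p | no s′q = ⊥-elim (exit-indices-distinct b∼p b∼q p≢q ep eq
                            (exit-unique b∼za false (Exits⇒off-branch b∼p b∼za p≢za ep , s′p)
                                                    (Exits⇒off-branch b∼q b∼za q≢za eq , s′q)))

  nonleaf-vertex-separated : ∀ {b a} → ¬ Leaf G b → b ≢ a → ∃[ j ] b ∈ P j × a ∉ P j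
  nonleaf-vertex-separated {b} ¬leaf b≢a =
    let za , b∼za , sa = toward b≢a
        p , q , b∼p , b∼q , p≢q , p≢za , q≢za = two-other-neighbours ¬leaf (no-deg-2 b) b∼za
    in separated-by-exits b∼za sa b∼p b∼q p≢q p≢za q≢za (proj₂ (exit-index b∼p)) (proj₂ (exit-index b∼q))

  -- Leaving the three branches at a gives three paths through a; were xy on all of them, two would
  -- cross it in the same direction, which only one path does.
  off-edge-by-exits : ∀ {a x y p₁ p₂ p₃ j₁ j₂ j₃} → x ∼ y → a ∼ p₁ → a ∼ p₂ → a ∼ p₃ → p₁ ≢ p₂ → p₁ ≢ p₃ → p₂ ≢ p₃ →
                      Exits a p₁ true j₁ → Exits a p₂ true j₂ → Exits a p₃ true j₃ →
                      ∃[ j ] a ∈ P j × ¬ OnPath (ed x y) (P j)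
  off-edge-by-exits {j₁ = j₁} {j₂} {j₃} x∼y a∼p₁ a∼p₂ a∼p₃ p₁≢p₂ p₁≢p₃ p₂≢p₃ e₁ e₂ e₃
    with off-or-Exits x∼y j₁ | off-or-Exits x∼y j₂ | off-or-Exits x∼y j₃
  ... | inj₁ off | _        | _        = j₁ , Exits⇒source∈P a∼p₁ e₁ , off
  ... | inj₂ _   | inj₁ off | _        = j₂ , Exits⇒source∈P a∼p₂ e₂ , off
  ... | inj₂ _   | inj₂ _   | inj₁ off = j₃ , Exits⇒source∈P a∼p₃ e₃ , off
  ... | inj₂ c₁  | inj₂ c₂  | inj₂ c₃  = ⊥-elim (pigeonhole-three-into-two (exit-unique x∼y true) (exit-unique x∼y false)
        (exit-indices-distinct a∼p₁ a∼p₂ p₁≢p₂ e₁ e₂) (exit-indices-distinct a∼p₁ a∼p₃ p₁≢p₃ e₁ e₃)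
        (exit-indices-distinct a∼p₂ a∼p₃ p₂≢p₃ e₂ e₃) c₁ c₂ c₃)

  nonleaf-vertex-off-edge : ∀ {a x y} → ¬ Leaf G a → x ∼ y → ∃[ j ] a ∈ P j × ¬ OnPath (ed x y) (P j)
  nonleaf-vertex-off-edge {a} ¬leaf x∼y =
    let p₁ , p₂ , p₃ , a∼p₁ , a∼p₂ , a∼p₃ , p₁≢p₂ , p₁≢p₃ , p₂≢p₃ =
          three-neighbours ¬leaf (no-deg-2 a) (proj₂ (has-neighbour a))
    in off-edge-by-exits x∼y a∼p₁ a∼p₂ a∼p₃ p₁≢p₂ p₁≢p₃ p₂≢p₃
         (proj₂ (exit-index a∼p₁)) (proj₂ (exit-index a∼p₂)) (proj₂ (exit-index a∼p₃))

  endpoint-not-leaf : ∀ {x y} → ¬ Leaf G x → ¬ Leaf G y → ∀ b → ¬ Leaf G (endpoint x y b)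
  endpoint-not-leaf ¬leaf-x _ false = ¬leaf-x
  endpoint-not-leaf _ ¬leaf-y true  = ¬leaf-y

  other-leaf-on-side : ∀ {x y} → x ∼ y → ¬ Leaf G x → ¬ Leaf G y → ∀ γ {a} → Leaf G a →
                       ∃[ k ] side x y (ℓ k) ≡ γ × ℓ k ≢ a
  other-leaf-on-side {x} {y} x∼y ¬leaf-x ¬leaf-y γ {a} leaf-a =
    leaf-index-in-region (λ w → side≟ x y γ w ×-dec ¬? (w ≟ a))
      (side-endpoint x∼y γ , λ { refl → endpoint-not-leaf ¬leaf-x ¬leaf-y γ leaf-a }) boundary
    where
      boundary : ∀ {w m} → side x y w ≡ γ × w ≢ a → w ∼ m → ¬ (side x y m ≡ γ × m ≢ a) →
                 m ≡ a ⊎ (w ≡ endpoint x y γ × m ≡ endpoint x y (not γ))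
      boundary {w} {m} (sw , _) w∼m ¬Rm with side x y m ≟ᵇ γ
      ... | yes sm = inj₁ (decidable-stable (m ≟ a) (¬Rm ∘ (sm ,_)))
      ... | no sm≢γ = inj₂ (side-boundary x∼y w∼m sw sm≢γ)

  leaf-separated-at : ∀ {x y i} j → x ∼ y → side x y (ℓ j) ≢ side x y (ℓ i) →
                      side x y (ℓ (cycSuc j)) ≡ side x y (ℓ i) → ℓ (cycSuc j) ≢ ℓ i →
                      Distinguishes P (vx (ℓ i)) (ed x y)
  leaf-separated-at {x} {y} {i} j x∼y sj≢ sj′ ℓj′≢ℓi = Distinguishes-sym (separated-by j
    (sides-differ⇒OnPath-edge x∼y (P-path j) (sj≢ ∘ flip trans sj′))
    (λ ℓi∈ → [ (λ { refl → sj≢ refl }) , (λ { refl → ℓj′≢ℓi refl }) ]′ (ℓ∈P⇒endpoint ℓi∈)))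

  leaf-vertex-edge-distinguished : ∀ {x y} → x ∼ y → ¬ Leaf G x → ¬ Leaf G y → ∀ i →
                                   Distinguishes P (vx (ℓ i)) (ed x y)
  leaf-vertex-edge-distinguished {x} {y} x∼y ¬leaf-x ¬leaf-y i with side x y (ℓ i) ≟ᵇ side x y (ℓ (cycSuc i))
  ... | yes same = separated-by i (ℓ∈P i) (λ on → OnPath-edge⇒sides-differ x∼y (P-path i) on same)
  ... | no sides≢ =
    let k , Rk = other-leaf-on-side x∼y ¬leaf-x ¬leaf-y γ (ℓ-leaf i)
        j , ¬Rj , sj′ , ℓj′≢ℓi = cycSuc-entering (λ j → side≟ x y γ (ℓ j) ×-dec ¬? (ℓ j ≟ ℓ i))
                                   (λ R′ → sides≢ (sym (proj₁ R′))) Rk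
    in leaf-separated-at j x∼y (λ sj → ¬Rj (sj , λ ℓj≡ℓi → sides≢ (sym (subst (λ j → side x y (ℓ (cycSuc j)) ≡ γ)
                                                                                (ℓ-injective _ _ ℓj≡ℓi) sj′))))
                         sj′ ℓj′≢ℓi
    where
      γ = side x y (ℓ i)

  vertex-edge-distinguished : ∀ {a x y} → x ∼ y → ¬ Leaf G x → ¬ Leaf G y → Distinguishes P (vx a) (ed x y)
  vertex-edge-distinguished {a} x∼y ¬leaf-x ¬leaf-y with Leaf? a
  ... | no ¬leaf = let j , a∈ , off = nonleaf-vertex-off-edge ¬leaf x∼y in separated-by j a∈ off
  ... | yes leaf with i , refl ← ℓ-surjective a leaf = leaf-vertex-edge-distinguished x∼y ¬leaf-x ¬leaf-y i

  leaves-distinguished : ∀ {i k} → i ≢ k → Distinguishes P (vx (ℓ i)) (vx (ℓ k))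
  leaves-distinguished {i} {k} i≢k with ℓ k ∈? P i
  ... | no ℓk∉ = separated-by i (ℓ∈P i) ℓk∉
  ... | yes ℓk∈ with ℓ∈P⇒endpoint ℓk∈
  ...   | inj₁ k≡i  = ⊥-elim (i≢k (sym k≡i))
  ...   | inj₂ refl = Distinguishes-sym (separated-by (cycSuc i) (ℓ∈P (cycSuc i))
                        (λ ℓi∈ → [ i≢k , cycSuc²≢id 3≤h i ∘ sym ]′ (ℓ∈P⇒endpoint ℓi∈)))

  vertices-distinguished : ∀ {a b} → a ≢ b → Distinguishes P (vx a) (vx b)
  vertices-distinguished {a} {b} a≢b with Leaf? a | Leaf? b
  ... | no ¬leaf-a | _ = let j , a∈ , b∉ = nonleaf-vertex-separated ¬leaf-a a≢b in separated-by j a∈ b∉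
  ... | yes _ | no ¬leaf-b =
    let j , b∈ , a∉ = nonleaf-vertex-separated ¬leaf-b (a≢b ∘ sym) in Distinguishes-sym (separated-by j b∈ a∉)
  ... | yes leaf-a | yes leaf-b with i , refl ← ℓ-surjective a leaf-a | k , refl ← ℓ-surjective b leaf-b =
    leaves-distinguished (a≢b ∘ cong ℓ)

  paths-distinct : PairwiseDistinct P
  paths-distinct i j i≢j same with ℓ∈P⇒endpoint (proj₁ (same (vx (ℓ i))) (ℓ∈P i)) | ℓ∈P⇒endpoint (proj₂ (same (vx (ℓ j))) (ℓ∈P j))
  ... | inj₁ i≡j  | _         = i≢j i≡j
  ... | inj₂ _    | inj₁ j≡i  = i≢j (sym j≡i)
  ... | inj₂ refl | inj₂ j≡j″ = cycSuc²≢id 3≤h j (sym j≡j″)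

  separates-edges : Separates P (InE G)
  separates-edges (ed u z) (ed x y) u∼z x∼y = edges-distinguished u∼z x∼y

  covers-edges : Covers P (InE G)
  covers-edges (ed u z) u∼z = edge-covered u∼z

  separates-inner : Separates P (InVE* G)
  separates-inner (vx a)   (vx b)   _           _                   = vertices-distinguished
  separates-inner (vx a)   (ed x y) _           (x∼y , ¬lx , ¬ly)   _ = vertex-edge-distinguished x∼y ¬lx ¬ly
  separates-inner (ed x y) (vx a)   (x∼y , ¬lx , ¬ly) _           _ = Distinguishes-sym (vertex-edge-distinguished x∼y ¬lx ¬ly)
  separates-inner (ed u z) (ed x y) (u∼z , _)   (x∼y , _)           = edges-distinguished u∼z x∼y

  covers-inner : Covers P (InVE* G)
  covers-inner (vx v)   _         = vertex-covered v
  covers-inner (ed u z) (u∼z , _) = edge-covered u∼z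

lemma4p6 : ∀ {n} (G : Graph n) → IsTree G → (∀ v → deg G v ≢ 2) → 3 ≤ h1 G →
           (ρ : Rotation G) → (ℓ : Fin (h1 G) → Fin n) → LeafCyclicOrder G ρ ℓ →
           (P : Fin (h1 G) → List (Fin n)) → (∀ i → PathFrom G (ℓ i) (ℓ (cycSuc i)) (P i)) →
           PairwiseDistinct P × Separates P (InE G) × Covers P (InE G) ×
           Separates P (InVE* G) × Covers P (InVE* G)
lemma4p6 G (connected , acyclic) no-deg-2 3≤h ρ ℓ (ℓ-injective , ℓ-leaf , ℓ-surjective , ℓ-next) P P-path =
  paths-distinct , separates-edges , covers-edges , separates-inner , covers-inner
  where
    open Separation G connected acyclic no-deg-2 ρ 3≤h ℓ ℓ-injective ℓ-leaf ℓ-surjective ℓ-next P P-path
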